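{- Let $P,Q$ be second-order polynomials, $q\in\mathrm{mon}$ and $k\in\mathbb{N}$. If there are $p\in\mathrm{mon}$ and $n\in\mathbb{N}$ with $P(p)(n)>Q(p\times q)((n+1)^k)$, then for every $C\in\mathbb{N}$ there is $p'\in\mathrm{mon}$ such that $(\mathtt{L}(P))(p')(n)>C+(\mathtt{L}(Q))(p'\times q)((n+1)^k)$.
   Context: $\mathrm{mon}$ denotes the set of strictly monotone functions $\mathbb{N}\to\mathbb{N}$; $p\times q$ denotes pointwise product. Second-order polynomials in a type-1 variable $\mathtt{L}$ and type-0 variable $\mathtt{n}$ are built from positive integers and $\mathtt{n}$ by $+$, $\cdot$ and $\mathtt{L}(\cdot)$; $P(p)(k)$ is the value with $\mathtt{L}$ interpreted as $p\in\mathrm{mon}$ and $\mathtt{n}$ as $k$. In particular $(\mathtt{L}(P))(p)(k)=p(P(p)(k))$. -}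

module Defs where

open import Data.Nat using (ℕ; suc; _+_; _*_; _<_)
open import Data.Product using (Σ; _,_; proj₁)

StrictlyMonotone : (ℕ → ℕ) → Set
StrictlyMonotone f = ∀ {m n} → m < n → f m < f n

Mon : Set
Mon = Σ (ℕ → ℕ) StrictlyMonotone

_×ₚ_ : (ℕ → ℕ) → (ℕ → ℕ) → (ℕ → ℕ)
(p ×ₚ q) k = p k * q k

data SOPoly : Set where
  const : ℕ → SOPoly          -- const c denotes the positive integer c + 1
  var   : SOPoly
  _⊕_   : SOPoly → SOPoly → SOPoly
  _⊗_   : SOPoly → SOPoly → SOPoly
  L     : SOPoly → SOPoly

⟦_⟧ : SOPoly → (ℕ → ℕ) → ℕ → ℕ
⟦ const c ⟧ p k = suc c
⟦ var ⟧     p k = k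
⟦ P ⊕ Q ⟧   p k = ⟦ P ⟧ p k + ⟦ Q ⟧ p k
⟦ P ⊗ Q ⟧   p k = ⟦ P ⟧ p k * ⟦ Q ⟧ p k
⟦ L P ⟧     p k = p (⟦ P ⟧ p k)

-- Put b = Q(p×q)((n+1)^k) and raise p by (x ∸ b)·D, with D = C + p(b)q(b) + 1.
-- Evaluating Q only queries its function at arguments ≤ the final value b,
-- where nothing changed, so Q(p′×q)((n+1)^k) = b still; meanwhile
-- P(p′)(n) ≥ P(p)(n) > b, so L(P) picks up the added D, and L(Q) equals p(b)q(b).
module Submission where

open import Defs
open import Data.Nat using (ℕ; suc; zero; _+_; _*_; _∸_; _^_; _>_; _≤_; _<_; z≤n; s≤s; >-nonZero)
open import Data.Nat.Properties
open import Data.Product using (Σ; proj₁; _,_)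
open import Data.Sum using (inj₁; inj₂)
open import Relation.Binary.Core using (_Preserves_⟶_)
open import Relation.Binary.PropositionalEquality

Inflationary : (ℕ → ℕ) → Set
Inflationary f = ∀ x → x ≤ f x

strictlyMonotone⇒inflationary : ∀ {f} → StrictlyMonotone f → Inflationary f
strictlyMonotone⇒inflationary sm zero    = z≤n
strictlyMonotone⇒inflationary sm (suc x) = ≤-trans (s≤s (strictlyMonotone⇒inflationary sm x)) (sm (n<1+n x))

strictlyMonotone⇒monotone : ∀ {f} → StrictlyMonotone f → f Preserves _≤_ ⟶ _≤_
strictlyMonotone⇒monotone sm x≤y with m≤n⇒m<n∨m≡n x≤y
... | inj₁ x<y  = <⇒≤ (sm x<y)
... | inj₂ refl = ≤-refl

×ₚ-inflationary : ∀ {f g} → Inflationary f → Inflationary g → Inflationary (f ×ₚ g)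
×ₚ-inflationary inf ing zero    = z≤n
×ₚ-inflationary inf ing (suc x) = ≤-trans (m≤m*n (suc x) (suc x)) (*-mono-≤ (inf (suc x)) (ing (suc x)))

⟦⟧-mono : ∀ {f g} → (∀ x → f x ≤ g x) → g Preserves _≤_ ⟶ _≤_ → ∀ P k → ⟦ P ⟧ f k ≤ ⟦ P ⟧ g k
⟦⟧-mono f≤g g-mono (const c) k = ≤-refl
⟦⟧-mono f≤g g-mono var       k = ≤-refl
⟦⟧-mono f≤g g-mono (P ⊕ Q)   k = +-mono-≤ (⟦⟧-mono f≤g g-mono P k) (⟦⟧-mono f≤g g-mono Q k)
⟦⟧-mono f≤g g-mono (P ⊗ Q)   k = *-mono-≤ (⟦⟧-mono f≤g g-mono P k) (⟦⟧-mono f≤g g-mono Q k)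
⟦⟧-mono f≤g g-mono (L P)     k = ≤-trans (f≤g _) (g-mono (⟦⟧-mono f≤g g-mono P k))

⟦⟧-positive : ∀ {f m} → Inflationary f → 1 ≤ m → ∀ P → 1 ≤ ⟦ P ⟧ f m
⟦⟧-positive inf m≥1 (const c) = s≤s z≤n
⟦⟧-positive inf m≥1 var       = m≥1
⟦⟧-positive inf m≥1 (P ⊕ Q)   = ≤-trans (⟦⟧-positive inf m≥1 P) (m≤m+n _ _)
⟦⟧-positive inf m≥1 (P ⊗ Q)   = *-mono-≤ (⟦⟧-positive inf m≥1 P) (⟦⟧-positive inf m≥1 Q)
⟦⟧-positive inf m≥1 (L P)     = ≤-trans (⟦⟧-positive inf m≥1 P) (inf _)

-- For inflationary f and positive input every intermediate value of the
-- evaluation is at most the result (positivity handles the factors of ⊗).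
⟦⟧-local : ∀ {f g m N} → Inflationary f → 1 ≤ m → (∀ x → x ≤ N → f x ≡ g x)
         → ∀ P → ⟦ P ⟧ f m ≤ N → ⟦ P ⟧ g m ≡ ⟦ P ⟧ f m
⟦⟧-local inf m≥1 f≡g (const c) _ = refl
⟦⟧-local inf m≥1 f≡g var       _ = refl
⟦⟧-local inf m≥1 f≡g (P ⊕ Q)   ≤N = cong₂ _+_
  (⟦⟧-local inf m≥1 f≡g P (≤-trans (m≤m+n _ _) ≤N))
  (⟦⟧-local inf m≥1 f≡g Q (≤-trans (m≤n+m _ _) ≤N))
⟦⟧-local inf m≥1 f≡g (P ⊗ Q)   ≤N = cong₂ _*_
  (⟦⟧-local inf m≥1 f≡g P (≤-trans (m≤m*n _ _ {{>-nonZero (⟦⟧-positive inf m≥1 Q)}}) ≤N))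
  (⟦⟧-local inf m≥1 f≡g Q (≤-trans (m≤n*m _ _ {{>-nonZero (⟦⟧-positive inf m≥1 P)}}) ≤N))
⟦⟧-local {f} {g} {m} {N} inf m≥1 f≡g (L P) ≤N = begin
  g (⟦ P ⟧ g m) ≡⟨ cong g (⟦⟧-local inf m≥1 f≡g P arg≤N) ⟩
  g (⟦ P ⟧ f m) ≡⟨ sym (f≡g _ arg≤N) ⟩
  f (⟦ P ⟧ f m) ∎
  where
  open ≡-Reasoning
  arg≤N : ⟦ P ⟧ f m ≤ N
  arg≤N = ≤-trans (inf _) ≤N

raiseAbove : ℕ → ℕ → (ℕ → ℕ) → ℕ → ℕ
raiseAbove b D p x = p x + (x ∸ b) * D

raiseAbove-strictlyMonotone : ∀ {p} b D → StrictlyMonotone p → StrictlyMonotone (raiseAbove b D p)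
raiseAbove-strictlyMonotone b D sm x<y = +-mono-<-≤ (sm x<y) (*-monoˡ-≤ D (∸-monoˡ-≤ b (<⇒≤ x<y)))

raiseAbove-≥ : ∀ b D p x → p x ≤ raiseAbove b D p x
raiseAbove-≥ b D p x = m≤m+n (p x) _

raiseAbove-below : ∀ {b x} D p → x ≤ b → raiseAbove b D p x ≡ p x
raiseAbove-below {b} {x} D p x≤b = begin
  p x + (x ∸ b) * D ≡⟨ cong (λ d → p x + d * D) (m≤n⇒m∸n≡0 x≤b) ⟩
  p x + 0           ≡⟨ +-identityʳ (p x) ⟩
  p x               ∎
  where open ≡-Reasoning

raiseAbove-above : ∀ {b x} D p → b < x → D ≤ raiseAbove b D p x
raiseAbove-above {b} {x} D p b<x = begin
  D                 ≡⟨ sym (*-identityˡ D) ⟩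
  1 * D             ≤⟨ *-monoˡ-≤ D (m<n⇒0<n∸m b<x) ⟩
  (x ∸ b) * D       ≤⟨ m≤n+m _ (p x) ⟩
  p x + (x ∸ b) * D ∎
  where open ≤-Reasoning

lemma9 : (P Q : SOPoly) (q : Mon) (k : ℕ) (p : Mon) (n : ℕ)
    → ⟦ P ⟧ (proj₁ p) n > ⟦ Q ⟧ (proj₁ p ×ₚ proj₁ q) (suc n ^ k)
    → (C : ℕ) → Σ Mon (λ p′ → ⟦ L P ⟧ (proj₁ p′) n > C + ⟦ L Q ⟧ (proj₁ p′ ×ₚ proj₁ q) (suc n ^ k))
lemma9 P Q (q , q-sm) k (p , p-sm) n P>Q C = (p′ , p′-sm) , (begin-strict
  C + (p′ ×ₚ q) (⟦ Q ⟧ (p′ ×ₚ q) m) ≡⟨ cong (λ y → C + (p′ ×ₚ q) y) Q-unchanged ⟩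
  C + (p′ ×ₚ q) b                   ≡⟨ cong (C +_) (sym (agree b ≤-refl)) ⟩
  C + (p ×ₚ q) b                    <⟨ n<1+n _ ⟩
  D                                 ≤⟨ raiseAbove-above D p P-above ⟩
  p′ (⟦ P ⟧ p′ n)                   ∎)
  where
  open ≤-Reasoning
  m b D : ℕ
  m = suc n ^ k
  b = ⟦ Q ⟧ (p ×ₚ q) m
  D = suc (C + (p ×ₚ q) b)

  p′ : ℕ → ℕ
  p′ = raiseAbove b D p

  p′-sm : StrictlyMonotone p′
  p′-sm = raiseAbove-strictlyMonotone b D p-sm

  agree : ∀ x → x ≤ b → (p ×ₚ q) x ≡ (p′ ×ₚ q) x
  agree x x≤b = cong (_* q x) (sym (raiseAbove-below D p x≤b))

  Q-unchanged : ⟦ Q ⟧ (p′ ×ₚ q) m ≡ b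
  Q-unchanged = ⟦⟧-local
    (×ₚ-inflationary (strictlyMonotone⇒inflationary p-sm) (strictlyMonotone⇒inflationary q-sm))
    (m^n>0 (suc n) k) agree Q ≤-refl

  P-above : b < ⟦ P ⟧ p′ n
  P-above = <-≤-trans P>Q (⟦⟧-mono (raiseAbove-≥ b D p) (strictlyMonotone⇒monotone p′-sm) P n)
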